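{- Let $k\ge 1$ and let $a,b$ be positive integers such that the order of every element of the symmetric group $S_k$ divides $a$ or divides $b$. Then for all $x,y\in S_k$, $$(xy)^a(yx)^b=(yx)^b(xy)^a.$$
   Context: $S_k$ is the symmetric group on $\{1,\ldots,k\}$. -}

module Defs where

open import Data.Nat using (ℕ; zero; suc; _<_)
open import Data.Fin.Permutation using (Permutation′; id; _∘ₚ_; _≈_)
open import Relation.Nullary using (¬_)
open import Data.Product using (_×_)

_^ₚ_ : ∀ {k} → Permutation′ k → ℕ → Permutation′ k
x ^ₚ zero  = id
x ^ₚ suc n = x ∘ₚ (x ^ₚ n)

_·_ : ∀ {k} → Permutation′ k → Permutation′ k → Permutation′ k
x · y = x ∘ₚ y

IsOrder : ∀ {k} → Permutation′ k → ℕ → Set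
IsOrder x n = (0 < n) × ((x ^ₚ n) ≈ id) × (∀ m → 0 < m → m < n → ¬ ((x ^ₚ m) ≈ id))

-- The order n of x·y divides a or b.  If n ∣ a then (x·y)^a is the identity and commutes with
-- everything.  If n ∣ b, note that y·x = x⁻¹(x·y)x is conjugate to x·y, so (y·x)^b is the identity.
-- The order exists because x^(k!) = id: every orbit of x has length d ≤ k, and d ∣ k!.
module Submission where

open import Defs
open import Data.Nat using (ℕ; zero; suc; _+_; _*_; _∸_; _<_; _≤_; _≥_; _!; _<?_)
open import Data.Nat.Properties
  using (+-comm; m+[n∸m]≡n; m<n⇒0<n∸m; m∸n≤m; ≤-trans; ≤-pred; <⇒≤; n<1+n; 1≤n!; anyUpTo?)
open import Data.Nat.Divisibility using (_∣_; divides; ∣-trans; m∣m*n; m≤n⇒m!∣n!)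
open import Data.Nat.Induction using (<-rec)
open import Data.Fin using (Fin; toℕ)
open import Data.Fin.Properties using (pigeonhole; toℕ<n; all?; _≟_)
open import Data.Fin.Permutation using (Permutation′; _≈_; _⟨$⟩ʳ_; _⟨$⟩ˡ_; inverseʳ; id)
open import Data.Product using (∃; _,_; _×_)
open import Data.Sum using (_⊎_; inj₁; inj₂)
open import Function.Bundles using (Injection)
open import Function.Properties.Inverse using (↔⇒↣)
open import Relation.Nullary using (¬_; yes; no)
open import Relation.Nullary.Decidable using (_×-dec_)
open import Relation.Unary using (Pred; Decidable)
open import Relation.Binary.PropositionalEquality using (_≡_; refl; sym; trans; cong; module ≡-Reasoning)

module _ {p} {P : Pred ℕ p} where

  HasLeastWitness : Set p
  HasLeastWitness = ∃ λ m → P m × (∀ j → j < m → ¬ P j)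

  least-witness : Decidable P → ∀ n → P n → HasLeastWitness
  least-witness P? = <-rec (λ n → P n → HasLeastWitness) step
    where
    step : ∀ n → (∀ {j} → j < n → P j → HasLeastWitness) → P n → HasLeastWitness
    step n smaller Pn with anyUpTo? P? n
    ... | yes (j , j<n , Pj) = smaller j<n Pj
    ... | no none            = n , Pn , λ j j<n Pj → none (j , j<n , Pj)

m≤n⇒m∣n! : ∀ {m n} → 0 < m → m ≤ n → m ∣ n !
m≤n⇒m∣n! {suc m} _ m≤n = ∣-trans (m∣m*n (m !)) (m≤n⇒m!∣n! m≤n)

module _ {k : ℕ} where

  ⟨$⟩ʳ-injective : (π : Permutation′ k) {i j : Fin k} → π ⟨$⟩ʳ i ≡ π ⟨$⟩ʳ j → i ≡ j
  ⟨$⟩ʳ-injective π = Injection.injective (↔⇒↣ π)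

  ^ₚ-+ : (x : Permutation′ k) (m n : ℕ) (i : Fin k) →
         (x ^ₚ (m + n)) ⟨$⟩ʳ i ≡ (x ^ₚ n) ⟨$⟩ʳ ((x ^ₚ m) ⟨$⟩ʳ i)
  ^ₚ-+ x zero    n i = refl
  ^ₚ-+ x (suc m) n i = ^ₚ-+ x m n (x ⟨$⟩ʳ i)

  ^ₚ-*-fixes : (x : Permutation′ k) (q d : ℕ) {i : Fin k} →
               (x ^ₚ d) ⟨$⟩ʳ i ≡ i → (x ^ₚ (q * d)) ⟨$⟩ʳ i ≡ i
  ^ₚ-*-fixes x zero    d fix = refl
  ^ₚ-*-fixes x (suc q) d {i} fix = begin
    (x ^ₚ (d + q * d)) ⟨$⟩ʳ i             ≡⟨ ^ₚ-+ x d (q * d) i ⟩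
    (x ^ₚ (q * d)) ⟨$⟩ʳ ((x ^ₚ d) ⟨$⟩ʳ i) ≡⟨ cong ((x ^ₚ (q * d)) ⟨$⟩ʳ_) fix ⟩
    (x ^ₚ (q * d)) ⟨$⟩ʳ i                 ≡⟨ ^ₚ-*-fixes x q d fix ⟩
    i                                     ∎
    where open ≡-Reasoning

  ^ₚ-∣-fixes : (x : Permutation′ k) {d m : ℕ} {i : Fin k} →
               (x ^ₚ d) ⟨$⟩ʳ i ≡ i → d ∣ m → (x ^ₚ m) ⟨$⟩ʳ i ≡ i
  ^ₚ-∣-fixes x {d} fix (divides q refl) = ^ₚ-*-fixes x q d fix

  ^ₚ-∣-≈id : (x : Permutation′ k) {d m : ℕ} → (x ^ₚ d) ≈ id → d ∣ m → (x ^ₚ m) ≈ id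
  ^ₚ-∣-≈id x x^d≈id d∣m i = ^ₚ-∣-fixes x (x^d≈id i) d∣m

  -- Pigeonhole on the k + 1 points i, x i, …, x^k i of Fin k.
  orbit-returns : (x : Permutation′ k) (i : Fin k) →
                  ∃ λ d → 0 < d × d ≤ k × (x ^ₚ d) ⟨$⟩ʳ i ≡ i
  orbit-returns x i with pigeonhole (n<1+n k) (λ j → (x ^ₚ toℕ j) ⟨$⟩ʳ i)
  ... | s , t , s<t , same = toℕ t ∸ toℕ s , m<n⇒0<n∸m s<t , d≤k , returns
    where
    d = toℕ t ∸ toℕ s
    d≤k : d ≤ k
    d≤k = ≤-trans (m∸n≤m (toℕ t) (toℕ s)) (≤-pred (toℕ<n t))
    returns : (x ^ₚ d) ⟨$⟩ʳ i ≡ i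
    returns = ⟨$⟩ʳ-injective (x ^ₚ toℕ s) (begin
      (x ^ₚ toℕ s) ⟨$⟩ʳ ((x ^ₚ d) ⟨$⟩ʳ i) ≡⟨ ^ₚ-+ x d (toℕ s) i ⟨
      (x ^ₚ (d + toℕ s)) ⟨$⟩ʳ i          ≡⟨ cong (λ e → (x ^ₚ e) ⟨$⟩ʳ i) (+-comm d (toℕ s)) ⟩
      (x ^ₚ (toℕ s + d)) ⟨$⟩ʳ i          ≡⟨ cong (λ e → (x ^ₚ e) ⟨$⟩ʳ i) (m+[n∸m]≡n (<⇒≤ s<t)) ⟩
      (x ^ₚ toℕ t) ⟨$⟩ʳ i                ≡⟨ same ⟨
      (x ^ₚ toℕ s) ⟨$⟩ʳ i                ∎)
      where open ≡-Reasoning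

  ^ₚ-k!≈id : (x : Permutation′ k) → (x ^ₚ (k !)) ≈ id
  ^ₚ-k!≈id x i with orbit-returns x i
  ... | d , 0<d , d≤k , returns = ^ₚ-∣-fixes x returns (m≤n⇒m∣n! 0<d d≤k)

  order-exists : (x : Permutation′ k) → ∃ (IsOrder x)
  order-exists x =
    let n , (0<n , x^n≈id) , minimal = least-witness positive-period? (k !) (1≤n! k , ^ₚ-k!≈id x)
    in  n , 0<n , x^n≈id , λ m 0<m m<n x^m≈id → minimal m m<n (0<m , x^m≈id)
    where
    positive-period? : Decidable (λ n → 0 < n × (x ^ₚ n) ≈ id)
    positive-period? n = 0 <? n ×-dec all? (λ i → (x ^ₚ n) ⟨$⟩ʳ i ≟ i)

  ^ₚ-·-swap : (x y : Permutation′ k) (n : ℕ) (i : Fin k) →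
              ((y · x) ^ₚ n) ⟨$⟩ʳ (x ⟨$⟩ʳ i) ≡ x ⟨$⟩ʳ (((x · y) ^ₚ n) ⟨$⟩ʳ i)
  ^ₚ-·-swap x y zero    i = refl
  ^ₚ-·-swap x y (suc n) i = ^ₚ-·-swap x y n ((x · y) ⟨$⟩ʳ i)

  ·-swap-^ₚ-≈id : (x y : Permutation′ k) (n : ℕ) → ((x · y) ^ₚ n) ≈ id → ((y · x) ^ₚ n) ≈ id
  ·-swap-^ₚ-≈id x y n xy^n≈id j = begin
    ((y · x) ^ₚ n) ⟨$⟩ʳ j                          ≡⟨ cong ((y · x) ^ₚ n ⟨$⟩ʳ_) (inverseʳ x) ⟨
    ((y · x) ^ₚ n) ⟨$⟩ʳ (x ⟨$⟩ʳ (x ⟨$⟩ˡ j))        ≡⟨ ^ₚ-·-swap x y n (x ⟨$⟩ˡ j) ⟩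
    x ⟨$⟩ʳ (((x · y) ^ₚ n) ⟨$⟩ʳ (x ⟨$⟩ˡ j))        ≡⟨ cong (x ⟨$⟩ʳ_) (xy^n≈id (x ⟨$⟩ˡ j)) ⟩
    x ⟨$⟩ʳ (x ⟨$⟩ˡ j)                              ≡⟨ inverseʳ x ⟩
    j                                              ∎
    where open ≡-Reasoning

  ≈id-commutesˡ : (g h : Permutation′ k) → g ≈ id → (g · h) ≈ (h · g)
  ≈id-commutesˡ g h g≈id i = trans (cong (h ⟨$⟩ʳ_) (g≈id i)) (sym (g≈id (h ⟨$⟩ʳ i)))

  ≈id-commutesʳ : (g h : Permutation′ k) → h ≈ id → (g · h) ≈ (h · g)
  ≈id-commutesʳ g h h≈id i = sym (≈id-commutesˡ h g h≈id i)

proposition7 : (k : ℕ) → k ≥ 1 → (a b : ℕ) → 0 < a → 0 < b →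
    ((g : Permutation′ k) (n : ℕ) → IsOrder g n → n ∣ a ⊎ n ∣ b) →
    (x y : Permutation′ k) →
      (((x · y) ^ₚ a) · ((y · x) ^ₚ b)) ≈ (((y · x) ^ₚ b) · ((x · y) ^ₚ a))
proposition7 k _ a b _ _ orders-divide x y with order-exists (x · y)
... | n , n-is-order@(_ , xy^n≈id , _) with orders-divide (x · y) n n-is-order
...   | inj₁ n∣a = ≈id-commutesˡ ((x · y) ^ₚ a) ((y · x) ^ₚ b) (^ₚ-∣-≈id (x · y) xy^n≈id n∣a)
...   | inj₂ n∣b = ≈id-commutesʳ ((x · y) ^ₚ a) ((y · x) ^ₚ b)
          (·-swap-^ₚ-≈id x y b (^ₚ-∣-≈id (x · y) xy^n≈id n∣b))
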